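{- Let $\Delta\in\mathcal M_{N,M}$ and let $f$ and the digraph $\Gamma$ be as in the context. Then for every $i\in\{0,\dots,d-1\}$, $f(i)$ equals the length of the longest oriented path from $0$ to $i$ in $\Gamma$.
   Context: $N,M$ are positive integers, $d=\gcd(N,M)$, $n=N/d$, $m=M/d$. $\mathcal M_{N,M}$ is the set of $\Delta\subseteq\mathbb Z_{\ge0}$ with $\min\Delta=0$, $\Delta+N\subseteq\Delta$, $\Delta+M\subseteq\Delta$. The skeleton $S$ of $\Delta$ is the set of its $N$-generators (elements of $\Delta\setminus(\Delta+N)$) and $M$-cogenerators (elements of $(\Delta-M)\setminus\Delta$); $S_i=S\cap(d\mathbb Z+i)$. For $i\ne j$, $b_{ij}=\min\{y-x:x\in S_i,y\in S_j,y>x\}-1$ ($+\infty$ if empty). $m_0=0$ and $m_i=\max\sum_{\ell=1}^{k-1}(-b_{i_{\ell+1}i_\ell})$ over all sequences $i=i_1,\dots,i_k=0$ in $\{0,\dots,d-1\}$; $(m_1,\dots,m_{d-1})$ is the minimal integral acceptable shifting of $S$. Let $M_i=S_i+m_i$, let $f(i)\in\{0,\dots,d-1\}$ be the common residue modulo $d$ of the elements of $M_i$, and $s_i=\{\lfloor x/d\rfloor:x\in M_i\}$. $\Gamma$ is the digraph on vertex set $\{0,\dots,d-1\}$ with an edge $i\to j$ if and only if $f(i)<f(j)$ and $s_i\cap s_j\neq\emptyset$. -}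

module Defs where

open import Data.Nat as ℕ using (ℕ; zero; suc; NonZero; ≢-nonZero; ≢-nonZero⁻¹; >-nonZero⁻¹)
open import Data.Nat.GCD using (gcd; gcd[m,n]≢0)
open import Data.Integer as ℤ using (ℤ; +_; _-_; _≤_; _<_)
open import Data.Integer.DivMod using (_/ℕ_; _%ℕ_)
open import Data.Fin using (Fin; toℕ; fromℕ<)
open import Data.List using (List; []; _∷_; length; last)
open import Data.List.Relation.Unary.Linked using (Linked)
open import Data.List.Relation.Unary.Unique.Propositional using (Unique)
open import Data.Maybe using (just)
open import Data.Product using (Σ; ∃; ∃₂; _×_)
open import Data.Sum using (_⊎_; inj₁)
open import Relation.Binary.PropositionalEquality using (_≡_; _≢_)
open import Relation.Nullary using (¬_)

-- A subset Δ ⊆ ℤ≥0 is represented by a predicate on ℤ.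
-- Δ ∈ 𝓜_{N,M}:  Δ ⊆ ℤ≥0, min Δ = 0, Δ + N ⊆ Δ, Δ + M ⊆ Δ.
record InMNM (N M : ℕ) (Δ : ℤ → Set) : Set where
  field
    nonneg  : ∀ x → Δ x → + 0 ≤ x
    zeroIn  : Δ (+ 0)
    closedN : ∀ x → Δ x → Δ (x ℤ.+ + N)
    closedM : ∀ x → Δ x → Δ (x ℤ.+ + M)

module Setup (N M : ℕ) {{_ : NonZero N}} {{_ : NonZero M}} (Δ : ℤ → Set) where

  d : ℕ
  d = gcd N M

  instance
    d-nonZero : NonZero d
    d-nonZero = ≢-nonZero (gcd[m,n]≢0 N M (inj₁ (≢-nonZero⁻¹ N)))

  zeroV : Fin d
  zeroV = fromℕ< (>-nonZero⁻¹ d)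

  NGen : ℤ → Set
  NGen x = Δ x × ¬ Δ (x - + N)

  MCogen : ℤ → Set
  MCogen x = Δ (x ℤ.+ + M) × ¬ Δ x

  InS : ℤ → Set
  InS x = NGen x ⊎ MCogen x

  S : Fin d → ℤ → Set
  S i x = InS x × x %ℕ d ≡ toℕ i

  -- b_{ji} is finite and equals b : the minimum of y - x over x ∈ S_j, y ∈ S_i,
  -- y > x, equals b + 1   (only defined for j ≠ i)
  B : Fin d → Fin d → ℤ → Set
  B j i b = j ≢ i
          × (∃₂ λ x y → S j x × S i y × x < y × y - x ≡ b ℤ.+ + 1)
          × (∀ x y → S j x → S i y → x < y → b ℤ.+ + 1 ≤ y - x)

  -- Seq i s : a sequence i = i_1, i_2, …, i_k = 0 in {0,…,d-1} all of whose
  -- b_{i_{ℓ+1} i_ℓ} are finite, with s = Σ_{ℓ=1}^{k-1} (- b_{i_{ℓ+1} i_ℓ}).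
  -- (Sequences with an infinite b contribute -∞ and never attain the maximum.)
  data Seq : Fin d → ℤ → Set where
    stop : Seq zeroV (+ 0)
    step : ∀ {i j b s} → B j i b → Seq j s → Seq i (ℤ.- b ℤ.+ s)

  IsMinShift : (Fin d → ℤ) → Set
  IsMinShift m = (m zeroV ≡ + 0)
               × (∀ i → i ≢ zeroV →
                    Seq i (m i) × (∀ s → Seq i s → s ≤ m i))

  Mset : (Fin d → ℤ) → Fin d → ℤ → Set
  Mset m i z = ∃ λ x → S i x × z ≡ x ℤ.+ m i

  IsResidueFn : (Fin d → ℤ) → (Fin d → ℕ) → Set
  IsResidueFn m f = ∀ i z → Mset m i z → z %ℕ d ≡ f i

  sset : (Fin d → ℤ) → Fin d → ℤ → Set
  sset m i q = ∃ λ z → Mset m i z × q ≡ z /ℕ d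

  Edge : (Fin d → ℤ) → (Fin d → ℕ) → Fin d → Fin d → Set
  Edge m f i j = f i ℕ.< f j × ∃ λ q → sset m i q × sset m j q

  Path : (Fin d → ℤ) → (Fin d → ℕ) → Fin d → Fin d → ℕ → Set
  Path m f u v ℓ = Σ (List (Fin d)) λ vs →
      Linked (Edge m f) (u ∷ vs) × Unique (u ∷ vs)
    × last (u ∷ vs) ≡ just v × length vs ≡ ℓ

  LongestPathLength : (Fin d → ℤ) → (Fin d → ℕ) → Fin d → Fin d → ℕ → Set
  LongestPathLength m f u v ℓ =
    Path m f u v ℓ × (∀ ℓ' → Path m f u v ℓ' → ℓ' ℕ.≤ ℓ)

-- Along an optimal sequence i = i₁, …, i_k = 0 every step is tight, m(i_ℓ) = m(i_{ℓ+1}) − b, so the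
-- pair x ∈ S(i_{ℓ+1}), y ∈ S(i_ℓ) realising b is shifted to consecutive integers: some z ∈ M(i_{ℓ+1})
-- has z + 1 ∈ M(i_ℓ). Erasing loops and reversing gives a simple walk of this kind from 0 to i, with
-- fewer than d steps. Starting from f(0) = 0 the residue then rises by exactly one per step without
-- wrapping around, and z, z + 1 have the same quotient by d, so each step is an edge of Γ and f(i) is
-- the length of the walk. Conversely f strictly increases along edges of Γ, so no path is longer.

module Submission where

open import Defs
open import Data.Nat using (ℕ; NonZero)
open import Data.Integer using (ℤ)
open import Data.Fin using (Fin)

open import Level using (Level)
import Data.Nat as ℕ
import Data.Nat.Properties as ℕP
open import Data.Nat.DivMod using (m<n⇒m%n≡m)
open import Data.Integer as Z using (+_; _+_; _*_; -_; _-_; _≤_; _<_; +<+)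
import Data.Integer.Properties as ZP
open import Data.Integer.DivMod using (_/ℕ_; _%ℕ_; a≡a%ℕn+[a/ℕn]*n; n%ℕd<d)
open import Data.Integer.Tactic.RingSolver using (solve-∀)
open import Algebra.Properties.AbelianGroup ZP.+-0-abelianGroup using (\\-leftDividesʳ; ∙-cancelʳ)
import Data.Fin as F
import Data.Fin.Properties as FP
open import Data.List using (List; []; _∷_; _∷ʳ_; length; last; lookup)
open import Data.List.Properties using (length-++)
open import Data.List.Relation.Unary.Linked using (Linked; [-]; _∷_)
import Data.List.Relation.Unary.Linked as Linked
open import Data.List.Relation.Unary.Linked.Properties using (Linked⇒AllPairs; ++⁺)
open import Data.List.Relation.Unary.AllPairs using ([]; _∷_)
import Data.List.Relation.Unary.AllPairs as AllPairs
import Data.List.Relation.Unary.All as All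
open import Data.List.Relation.Unary.All using ([]; _∷_)
open import Data.List.Relation.Unary.All.Properties using (¬Any⇒All¬)
open import Data.List.Relation.Unary.Any using (here; there)
open import Data.List.Relation.Unary.Unique.Propositional using (Unique)
open import Data.List.Membership.Propositional using (_∈_)
open import Data.List.Membership.Propositional.Properties using (∈-lookup)
import Data.List.Membership.DecPropositional as DecMembership
open import Data.Maybe using (just)
open import Data.Maybe.Relation.Binary.Connected using (Connected; just)
open import Data.Product using (∃; _×_; _,_; proj₁; proj₂)
open import Data.Sum using (inj₁)
open import Function using (flip; _on_)
open import Function.Definitions using (Injective)
open import Relation.Binary.Core using (Rel; _⇒_)
open import Relation.Binary.Definitions using (DecidableEquality; tri<; tri≈; tri>)
open import Relation.Binary.PropositionalEquality
open import Relation.Nullary using (¬_; yes; no; contradiction)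

private
  variable
    a ℓ : Level
    A : Set a

+-cancelˡ-≤ : ∀ i {j k} → i + j ≤ i + k → j ≤ k
+-cancelˡ-≤ i {j} {k} le =
  subst₂ _≤_ (\\-leftDividesʳ i j) (\\-leftDividesʳ i k) (ZP.+-monoʳ-≤ (- i) le)

0≰0-n : ∀ n .{{_ : NonZero n}} → ¬ (+ 0 ≤ + 0 - + n)
0≰0-n (ℕ.suc n) ()

module _ (d : ℕ) {{_ : NonZero d}} where

  private
    +r+q*d<+r′+q′*d : ∀ {r r′ q q′} → r ℕ.< d → q < q′ → + r + q * + d < + r′ + q′ * + d
    +r+q*d<+r′+q′*d {r} {r′} {q} {q′} r<d q<q′ = begin-strict
      + r + q * + d    <⟨ ZP.+-monoˡ-< (q * + d) (+<+ r<d) ⟩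
      + d + q * + d    ≡⟨ ZP.suc-* q (+ d) ⟨
      Z.suc q * + d    ≤⟨ ZP.*-monoʳ-≤-nonNeg (+ d) (ZP.i<j⇒suc[i]≤j q<q′) ⟩
      q′ * + d         ≤⟨ ZP.i≤j+i (q′ * + d) (+ r′) ⟩
      + r′ + q′ * + d  ∎
      where open ZP.≤-Reasoning

  /ℕ-%ℕ-unique : ∀ {r q} → r ℕ.< d → (+ r + q * + d) /ℕ d ≡ q × (+ r + q * + d) %ℕ d ≡ r
  /ℕ-%ℕ-unique {r} {q} r<d with ZP.<-cmp q ((+ r + q * + d) /ℕ d)
  ... | tri< q<q₀ _ _ = contradiction (+r+q*d<+r′+q′*d r<d q<q₀) (ZP.<-irrefl division)
    where division = a≡a%ℕn+[a/ℕn]*n (+ r + q * + d) d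
  ... | tri> _ _ q₀<q =
    contradiction (+r+q*d<+r′+q′*d (n%ℕd<d (+ r + q * + d) d) q₀<q) (ZP.<-irrefl (sym division))
    where division = a≡a%ℕn+[a/ℕn]*n (+ r + q * + d) d
  ... | tri≈ _ q≡q₀ _ = sym q≡q₀ , sym (ZP.+-injective (∙-cancelʳ (q * + d) _ _ remainders))
    where
    remainders : + r + q * + d ≡ + ((+ r + q * + d) %ℕ d) + q * + d
    remainders = trans (a≡a%ℕn+[a/ℕn]*n (+ r + q * + d) d)
                       (cong (λ t → + ((+ r + q * + d) %ℕ d) + t * + d) (sym q≡q₀))

  /ℕ-%ℕ-suc : ∀ z → ℕ.suc (z %ℕ d) ℕ.< d
            → (z + + 1) /ℕ d ≡ z /ℕ d × (z + + 1) %ℕ d ≡ ℕ.suc (z %ℕ d)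
  /ℕ-%ℕ-suc z r+1<d =
    subst (λ w → w /ℕ d ≡ z /ℕ d × w %ℕ d ≡ ℕ.suc (z %ℕ d)) (sym shifted) (/ℕ-%ℕ-unique r+1<d)
    where
    reassoc : ∀ r q → r + q + + 1 ≡ + 1 + r + q
    reassoc = solve-∀
    shifted : z + + 1 ≡ + ℕ.suc (z %ℕ d) + z /ℕ d * + d
    shifted = trans (cong (_+ + 1) (a≡a%ℕn+[a/ℕn]*n z d)) (reassoc (+ (z %ℕ d)) (z /ℕ d * + d))

Walk : Rel A ℓ → A → A → List A → Set _
Walk R x y xs = Linked R (x ∷ xs) × last (x ∷ xs) ≡ just y

last-∷ʳ : ∀ (xs : List A) x → last (xs ∷ʳ x) ≡ just x
last-∷ʳ []           x = refl
last-∷ʳ (_ ∷ [])     x = refl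
last-∷ʳ (_ ∷ y ∷ ys) x = last-∷ʳ (y ∷ ys) x

reverse-Walk : ∀ {R : Rel A ℓ} {x y xs} → Walk R x y xs
             → ∃ λ ys → Walk (flip R) y x ys × length ys ≡ length xs
reverse-Walk {xs = []}     ([-] , refl) = [] , ([-] , refl) , refl
reverse-Walk {R = R} {x} {xs = z ∷ zs} (Rxz ∷ walk , ends)
  with reverse-Walk (walk , ends)
... | ys , (walk′ , ends′) , |ys|≡|zs| =
  ys ∷ʳ x , (++⁺ walk′ joint [-] , last-∷ʳ (_ ∷ ys) x) , length-∷ʳ
  where
  joint : Connected (flip R) (last (_ ∷ ys)) (just x)
  joint = subst (λ end → Connected (flip R) end (just x)) (sym ends′) (just Rxz)
  length-∷ʳ : length (ys ∷ʳ x) ≡ ℕ.suc (length zs)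
  length-∷ʳ = trans (length-++ ys) (trans (ℕP.+-comm (length ys) 1) (cong ℕ.suc |ys|≡|zs|))

module _ {A : Set a} (_≟_ : DecidableEquality A) {R : Rel A ℓ} where

  open DecMembership _≟_ using (_∈?_)

  private
    suffix-Walk : ∀ {x y z ys} → x ∈ y ∷ ys → Walk R y z ys → Unique (y ∷ ys)
                → ∃ λ zs → Walk R x z zs × Unique (x ∷ zs)
    suffix-Walk (here refl) walk unique = _ , walk , unique
    suffix-Walk {ys = _ ∷ _} (there x∈) (_ ∷ walk , ends) (_ ∷ unique) =
      suffix-Walk x∈ (walk , ends) unique

  loop-erase : ∀ {x y xs} → Walk R x y xs → ∃ λ ys → Walk R x y ys × Unique (x ∷ ys)
  loop-erase {xs = []} walk = [] , walk , [] ∷ []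
  loop-erase {x} {xs = w ∷ ws} (Rxw ∷ walk , ends) with loop-erase (walk , ends)
  ... | ys , walk′ , unique with x ∈? (w ∷ ys)
  ...   | yes x∈ = suffix-Walk x∈ walk′ unique
  ...   | no  x∉ = w ∷ ys , (Rxw ∷ proj₁ walk′ , proj₂ walk′) , ¬Any⇒All¬ _ x∉ ∷ unique

lookup-injective : ∀ {xs : List A} → Unique xs → Injective _≡_ _≡_ (lookup xs)
lookup-injective (_ ∷ _)  {F.zero}  {F.zero}  _  = refl
lookup-injective (x∉ ∷ _) {F.zero}  {F.suc j} eq = contradiction eq (All.lookup x∉ (∈-lookup j))
lookup-injective (x∉ ∷ _) {F.suc i} {F.zero}  eq = contradiction (sym eq) (All.lookup x∉ (∈-lookup i))
lookup-injective (_ ∷ unique) {F.suc i} {F.suc j} eq = cong F.suc (lookup-injective unique eq)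

Unique⇒length≤ : ∀ {n} {xs : List (Fin n)} → Unique xs → length xs ℕ.≤ n
Unique⇒length≤ unique = FP.injective⇒≤ (lookup-injective unique)

module _ {R : Rel A ℓ} (g : A → ℕ) (increasing : R ⇒ (ℕ._<_ on g)) where

  Linked⇒Unique : ∀ {xs} → Linked R xs → Unique xs
  Linked⇒Unique linked =
    AllPairs.map (λ lt eq → ℕP.<-irrefl (cong g eq) lt)
                 (Linked⇒AllPairs ℕP.<-trans (Linked.map increasing linked))

  Walk⇒+length≤ : ∀ {x y xs} → Walk R x y xs → g x ℕ.+ length xs ℕ.≤ g y
  Walk⇒+length≤ {x} {xs = []} ([-] , refl) = ℕP.≤-reflexive (ℕP.+-identityʳ (g x))
  Walk⇒+length≤ {x} {xs = z ∷ zs} (Rxz ∷ walk , ends) = begin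
    g x ℕ.+ ℕ.suc (length zs)  ≡⟨ ℕP.+-suc (g x) (length zs) ⟩
    ℕ.suc (g x) ℕ.+ length zs  ≤⟨ ℕP.+-monoˡ-≤ (length zs) (increasing Rxz) ⟩
    g z ℕ.+ length zs          ≤⟨ Walk⇒+length≤ (walk , ends) ⟩
    _                          ∎
    where open ℕP.≤-Reasoning

module _ (N M : ℕ) {{_ : NonZero N}} {{_ : NonZero M}} (Δ : ℤ → Set) (Δ∈𝓜 : InMNM N M Δ) where

  open Setup N M Δ

  append : ∀ {i s t} → Seq i s → Seq zeroV t → Seq i (s + t)
  append stop τ = subst (Seq zeroV) (sym (ZP.+-identityˡ _)) τ
  append (step {b = b} {s = s} Bji σ) τ =
    subst (Seq _) (sym (ZP.+-assoc (- b) s _)) (step {b = b} Bji (append σ τ))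

  module _ (m : Fin d → ℤ) (m-minShift : IsMinShift m) (f : Fin d → ℕ) (f-residue : IsResidueFn m f) where

    private
      m₀≡0 : m zeroV ≡ + 0
      m₀≡0 = proj₁ m-minShift

      m-maximal : ∀ {i s} → i ≢ zeroV → Seq i s → s ≤ m i
      m-maximal i≢0 = proj₂ (proj₂ m-minShift _ i≢0) _

    m-attained : ∀ i → Seq i (m i)
    m-attained i with i FP.≟ zeroV
    ... | yes refl = subst (Seq zeroV) (sym m₀≡0) stop
    ... | no  i≢0  = proj₁ (proj₂ m-minShift i i≢0)

    -- A vertex i ≠ 0 witnesses d > 1; then a sequence returning to 0 is a cycle that could be
    -- appended to an optimal sequence from i, so it cannot have positive weight.
    Seq⇒≤m : ∀ {i j s} → i ≢ zeroV → Seq j s → s ≤ m j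
    Seq⇒≤m {i} {j} {s} i≢0 σ with j FP.≟ zeroV
    ... | no  j≢0  = m-maximal j≢0 σ
    ... | yes refl = subst (s ≤_) (sym m₀≡0)
      (+-cancelˡ-≤ (m i) (subst (m i + s ≤_) (sym (ZP.+-identityʳ (m i)))
                                  (m-maximal i≢0 (append (m-attained i) σ))))

    B⇒m-step : ∀ {i j b} → i ≢ zeroV → B j i b → - b + m j ≤ m i
    B⇒m-step {j = j} {b} i≢0 Bji = m-maximal i≢0 (step {b = b} Bji (m-attained j))

    tight-step : ∀ {i j b s} → i ≢ zeroV → B j i b → Seq j s → - b + s ≡ m i → s ≡ m j
    tight-step {b = b} i≢0 Bji σ tight = ZP.≤-antisym (Seq⇒≤m i≢0 σ)
      (+-cancelˡ-≤ (- b) (subst (- b + m _ ≤_) (sym tight) (B⇒m-step {b = b} i≢0 Bji)))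

    Adjacent : Fin d → Fin d → Set
    Adjacent j i = ∃ λ z → Mset m j z × Mset m i (z + + 1)

    B⇒Adjacent : ∀ {i j b} → B j i b → m i ≡ - b + m j → Adjacent j i
    B⇒Adjacent {i} {j} {b} (_ , (x , y , x∈Sⱼ , y∈Sᵢ , _ , y-x≡b+1) , _) mᵢ≡ =
      x + m j , (x , x∈Sⱼ , refl) , (y , y∈Sᵢ , shifted)
      where
      regroup : ∀ x mⱼ b → x + mⱼ + + 1 ≡ b + + 1 + x + (- b + mⱼ)
      regroup = solve-∀
      cancel : ∀ y x t → y - x + x + t ≡ y + t
      cancel = solve-∀
      shifted : x + m j + + 1 ≡ y + m i
      shifted = begin
        x + m j + + 1              ≡⟨ regroup x (m j) b ⟩
        b + + 1 + x + (- b + m j)  ≡⟨ cong (λ t → t + x + (- b + m j)) (sym y-x≡b+1) ⟩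
        y - x + x + (- b + m j)    ≡⟨ cancel y x (- b + m j) ⟩
        y + (- b + m j)            ≡⟨ cong (λ t → y + t) (sym mᵢ≡) ⟩
        y + m i                    ∎
        where open ≡-Reasoning

    optimal-walk : ∀ {i s} → Seq i s → s ≡ m i → ∃ λ vs → Walk (flip Adjacent) i zeroV vs
    optimal-walk stop _ = [] , [-] , refl
    optimal-walk {i} (step {j = j} {b} {s} Bji σ) tight with i FP.≟ zeroV
    ... | yes refl = [] , [-] , refl
    ... | no  i≢0  =
      let vs , walk , ends = optimal-walk σ s≡mⱼ in j ∷ vs , adjacent ∷ walk , ends
      where
      s≡mⱼ : s ≡ m j
      s≡mⱼ = tight-step {b = b} i≢0 Bji σ tight
      adjacent : Adjacent j i
      adjacent = B⇒Adjacent {b = b} Bji (trans (sym tight) (cong (λ t → - b + t) s≡mⱼ))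

    f₀≡0 : f zeroV ≡ 0
    f₀≡0 = trans (sym (f-residue zeroV (+ 0) (+ 0 , 0∈S₀ , sym (cong (λ t → + 0 + t) m₀≡0)))) 0%d≡0
      where
      0%d≡0 : + 0 %ℕ d ≡ 0
      0%d≡0 = m<n⇒m%n≡m (ℕ.>-nonZero⁻¹ d)
      0∈S₀ : S zeroV (+ 0)
      0∈S₀ = inj₁ (InMNM.zeroIn Δ∈𝓜 , λ -N∈Δ → 0≰0-n N (InMNM.nonneg Δ∈𝓜 _ -N∈Δ))
           , trans 0%d≡0 (sym (FP.toℕ-fromℕ< _))

    Adjacent⇒Edge : ∀ {i j} → ℕ.suc (f j) ℕ.< d → Adjacent j i → f i ≡ ℕ.suc (f j) × Edge m f j i
    Adjacent⇒Edge {i} {j} fⱼ+1<d (z , z∈Mⱼ , z+1∈Mᵢ) =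
      fᵢ≡ , subst (f j ℕ.<_) (sym fᵢ≡) (ℕP.n<1+n (f j))
          , z /ℕ d , (z , z∈Mⱼ , refl) , (z + + 1 , z+1∈Mᵢ , sym (proj₁ next))
      where
      z%d≡fⱼ : z %ℕ d ≡ f j
      z%d≡fⱼ = f-residue j z z∈Mⱼ
      next = /ℕ-%ℕ-suc d z (subst (λ r → ℕ.suc r ℕ.< d) (sym z%d≡fⱼ) fⱼ+1<d)
      fᵢ≡ : f i ≡ ℕ.suc (f j)
      fᵢ≡ = trans (sym (f-residue i (z + + 1) z+1∈Mᵢ)) (trans (proj₂ next) (cong ℕ.suc z%d≡fⱼ))

    Adjacent-walk⇒Edge-walk : ∀ {i vs} → Walk (flip Adjacent) i zeroV vs → length vs ℕ.< d
                            → f i ≡ length vs × Linked (flip (Edge m f)) (i ∷ vs)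
    Adjacent-walk⇒Edge-walk {vs = []} ([-] , refl) _ = f₀≡0 , [-]
    Adjacent-walk⇒Edge-walk {vs = j ∷ vs} (adjacent ∷ walk , ends) |vs|<d
      with Adjacent-walk⇒Edge-walk (walk , ends) (ℕP.<-trans (ℕP.n<1+n _) |vs|<d)
    ... | fⱼ≡ , edges =
      let fᵢ≡ , edge = Adjacent⇒Edge (subst (λ n → ℕ.suc n ℕ.< d) (sym fⱼ≡) |vs|<d) adjacent
      in trans fᵢ≡ (cong ℕ.suc fⱼ≡) , edge ∷ edges

    path-of-length-f : ∀ i → Path m f zeroV i (f i)
    path-of-length-f i with optimal-walk (m-attained i) refl
    ... | _ , walk with loop-erase FP._≟_ walk
    ... | ys , simple , unique with Adjacent-walk⇒Edge-walk simple (Unique⇒length≤ unique)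
    ... | fᵢ≡|ys| , edges with reverse-Walk (edges , proj₂ simple)
    ... | zs , (path , ends) , |zs|≡|ys| =
      zs , path , Linked⇒Unique f proj₁ path , ends , trans |zs|≡|ys| (sym fᵢ≡|ys|)

    Path⇒length≤ : ∀ {i ℓ} → Path m f zeroV i ℓ → ℓ ℕ.≤ f i
    Path⇒length≤ {i} (vs , edges , _ , ends , refl) =
      subst (λ n → n ℕ.+ length vs ℕ.≤ f i) f₀≡0 (Walk⇒+length≤ f proj₁ (edges , ends))

mainTheorem10 : (N M : ℕ) {{nzN : NonZero N}} {{nzM : NonZero M}} (Δ : ℤ → Set)
    → InMNM N M Δ
    → (m : Fin (Setup.d N M Δ) → ℤ) → Setup.IsMinShift N M Δ m
    → (f : Fin (Setup.d N M Δ) → ℕ) → Setup.IsResidueFn N M Δ m f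
    → ∀ i → Setup.LongestPathLength N M Δ m f (Setup.zeroV N M Δ) i (f i)
mainTheorem10 N M Δ Δ∈𝓜 m m-minShift f f-residue i =
  path-of-length-f N M Δ Δ∈𝓜 m m-minShift f f-residue i ,
  λ _ → Path⇒length≤ N M Δ Δ∈𝓜 m m-minShift f f-residue
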